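{- Let $\mathcal{A}$ be a strongly connected NFA with $m$ states and let $\lambda=\lambda(\mathcal{A})$ be its period. For every $i\in\mathbb{Z}/\lambda\mathbb{Z}$, the set of minimal blocking factors of $\mathcal{A}$ of the form $\langle i:u\rangle$ is a regular language recognized by an NFA with $2^{\mathcal{O}(m)}$ states.
   Context: $\mathcal{A}=(Q,\Sigma,\delta,q_0,F)$ is an NFA whose underlying graph is strongly connected; its period $\lambda$ is the gcd of the lengths of its cycles. A $\lambda$-positional word is a word over the alphabet $(\mathbb{Z}/\lambda\mathbb{Z})\times\Sigma$ of the form $(n\bmod\lambda,a_0)((n+1)\bmod\lambda,a_1)\cdots((n+\ell)\bmod\lambda,a_\ell)$, written $\langle n:u\rangle$ with $u=a_0\cdots a_\ell$. $\widehat L(\mathcal{A})=\{\langle 0:v\rangle: v\in L(\mathcal{A})\}$. A positional word $\tau$ is a blocking factor of $\mathcal{A}$ if every positional word having $\tau$ as a factor is not in $\widehat L(\mathcal{A})$; it is a minimal blocking factor if no proper factor of $\tau$ is a blocking factor. -}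

module Defs where

open import Data.Nat using (ℕ; zero; suc; _+_; _*_; _<_)
open import Data.Fin using (Fin; toℕ)
open import Data.Bool using (Bool; true)
open import Data.List using (List; []; _∷_; _++_; length)
open import Data.Product using (Σ; ∃; ∃-syntax; _×_; _,_)
open import Relation.Binary.PropositionalEquality using (_≡_; _≢_)
open import Relation.Nullary using (¬_)

record NFA (m : ℕ) (Sym : Set) : Set where
  field
    δ     : Fin m → Sym → Fin m → Bool
    q₀    : Fin m
    final : Fin m → Bool
open NFA public

data Run {m : ℕ} {Sym : Set} (A : NFA m Sym) : Fin m → List Sym → Fin m → Set where
  run-nil  : ∀ {p} → Run A p [] p
  run-cons : ∀ {p q r a w} → δ A p a q ≡ true → Run A q w r → Run A p (a ∷ w) r

Accepts : ∀ {m Sym} → NFA m Sym → List Sym → Set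
Accepts A w = ∃[ q ] (Run A (q₀ A) w q × final A q ≡ true)

StronglyConnected : ∀ {m Sym} → NFA m Sym → Set
StronglyConnected A = ∀ p q → ∃[ w ] Run A p w q

CycleLength : ∀ {m Sym} → NFA m Sym → ℕ → Set
CycleLength A ℓ = 0 < ℓ × ∃[ p ] ∃[ w ] (Run A p w p × length w ≡ ℓ)

IsPeriod : ∀ {m Sym} → NFA m Sym → ℕ → Set
IsPeriod A lam =
  (∀ ℓ → CycleLength A ℓ → lam ∣ ℓ) ×
  (∀ d → (∀ ℓ → CycleLength A ℓ → d ∣ ℓ) → d ∣ lam)
  where open import Data.Nat.Divisibility using (_∣_)

_≡_[mod_] : ℕ → ℕ → ℕ → Set
a ≡ b [mod lam ] = ∃[ q ] ∃[ r ] (a + q * lam ≡ b + r * lam)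

-- PosRep lam n u w : w (a word over (ℤ/lamℤ) × Σ) is the positional word ⟨n : u⟩,
-- i.e. w = (n mod lam, a₀)((n+1) mod lam, a₁)⋯ for u = a₀a₁⋯.
data PosRep (lam : ℕ) {Sym : Set} : ℕ → List Sym → List (Fin lam × Sym) → Set where
  pos-nil  : ∀ {n} → PosRep lam n [] []
  pos-cons : ∀ {n a u p w} → toℕ p ≡ n [mod lam ] → PosRep lam (suc n) u w →
             PosRep lam n (a ∷ u) ((p , a) ∷ w)

Positional : ∀ lam {Sym : Set} → List (Fin lam × Sym) → Set
Positional lam {Sym} w = ∃[ n ] ∃[ u ] (0 < length {A = Sym} u × PosRep lam n u w)

InLHat : ∀ {m Sym} → NFA m Sym → ∀ lam → List (Fin lam × Sym) → Set
InLHat A lam w = ∃[ v ] (Accepts A v × PosRep lam 0 v w)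

Factor : ∀ {X : Set} → List X → List X → Set
Factor t s = ∃[ x ] ∃[ y ] (s ≡ x ++ t ++ y)

ProperFactor : ∀ {X : Set} → List X → List X → Set
ProperFactor t s = Factor t s × t ≢ s

Blocking : ∀ {m Sym} → NFA m Sym → ∀ lam → List (Fin lam × Sym) → Set
Blocking A lam τ = Positional lam τ ×
  (∀ σ → Positional lam σ → Factor τ σ → ¬ InLHat A lam σ)

MinBlocking : ∀ {m Sym} → NFA m Sym → ∀ lam → List (Fin lam × Sym) → Set
MinBlocking A lam τ = Blocking A lam τ × (∀ τ' → ProperFactor τ' τ → ¬ Blocking A lam τ')

{-# OPTIONS --safe #-}
-- In a strongly connected automaton of period λ all runs from q₀ to a state p have the
-- same length modulo λ, the phase of p.  Hence ⟨ c ∶ u ⟩ occurs in a word of L̂(A) iff A has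
-- a final state and u can be read from some state of phase c, which the subset construction
-- started in the states of phase c decides with 2^m states.  A blocking factor is minimal
-- iff removing its first or its last letter makes it non-blocking, so the minimal blocking
-- factors ⟨ i ∶ u ⟩ are recognised by a product of three such subset automata (reading u,
-- lagging one letter behind, and starting one letter late) with a counter checking the
-- labels modulo λ.  The counter is small because λ ≤ m: the states reached after r < λ
-- letters of a closed walk through q₀ have the pairwise distinct phases r.
module Submission where

open import Defs
open import Level using (0ℓ)
open import Data.Bool using (Bool; true; false)
open import Data.Bool.Properties using () renaming (_≟_ to _≟ᵇ_)
open import Data.Fin using (Fin; toℕ)
open import Data.Fin.Properties
  using (toℕ-fromℕ<; fromℕ<-cong; toℕ-injective; toℕ<n; injective⇒≤; any?; 1↔⊤; 2↔Bool; *↔×)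
  renaming (_≟_ to _≟ᶠ_)
open import Data.Fin.Subset using (Subset; _∈_; Nonempty)
open import Data.Fin.Subset.Properties using (_∈?_; nonempty?)
open import Data.List using (List; []; _∷_; _++_; [_]; length; map; foldl; take; drop)
open import Data.List.Properties
  using (++-assoc; ++-identityʳ; length-++; length-map; length-take; length-++-≤ˡ; length-++-≤ʳ;
         map-++; foldl-map; ∷-injective; ∷-injectiveˡ; ∷-injectiveʳ; take++drop≡id)
open import Data.Nat
  using (ℕ; zero; suc; _+_; _*_; _^_; _⊓_; _≤_; _<_; _≤?_; z≤n; s≤s; NonZero; >-nonZero; ≢-nonZero⁻¹)
open import Data.Nat.Properties
open import Algebra.Properties.CommutativeSemigroup +-commutativeSemigroup
  using (x∙yz≈y∙xz; xy∙z≈xz∙y)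
open import Data.Nat.DivMod
  using (_%_; _/_; _mod_; m%n<n; m%n%n≡m%n; m<n⇒m%n≡m; %-distribˡ-+; [m+kn]%n≡m%n; m≡m%n+[m/n]*n)
open import Data.Nat.Divisibility using (_∣_; divides; _∣0; 0∣⇒≡0; ∣⇒≤)
open import Data.Nat.Tactic.RingSolver using (solve-∀)
open import Data.Product using (∃-syntax; _×_; _,_; proj₁; proj₂)
open import Data.Product.Function.NonDependent.Propositional using (_×-⇔_; _×-↔_)
open import Data.Sum using (_⊎_; inj₁; inj₂)
open import Data.Unit using (⊤; tt)
open import Data.Vec using (Vec; []; _∷_; tabulate)
open import Data.Vec.Properties using ([]=⇒lookup; lookup⇒[]=; lookup∘tabulate)
open import Function.Bundles using (_⇔_; mk⇔; _↔_; mk↔ₛ′; Equivalence; Inverse)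
open import Function.Properties.Equivalence
  using () renaming (refl to ⇔-refl; sym to ⇔-sym; trans to ⇔-trans)
open import Function.Properties.Inverse using (↔-refl; ↔-sym; ↔-trans)
open import Function.Related.TypeIsomorphisms using (¬-cong-⇔)
open import Relation.Binary.PropositionalEquality
  using (_≡_; _≢_; refl; sym; trans; cong; cong₂; subst; module ≡-Reasoning)
open import Relation.Nullary using (¬_; Dec; yes; no; does; contradiction)
open import Relation.Nullary.Decidable using (dec-true; decidable-stable; _×-dec_; ¬?)
open import Relation.Unary using (Pred; Decidable; _∩_; ∁; _⊢_)

open Equivalence using (to; from)
open ≡-Reasoning

private
  variable
    S T X Y : Set
    a b e e′ n : ℕ

init : List X → List X
init []           = []
init (x ∷ [])     = []
init (x ∷ y ∷ xs) = x ∷ init (y ∷ xs)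

length-init : ∀ (x : X) xs → length (init (x ∷ xs)) ≡ length xs
length-init x []       = refl
length-init x (y ∷ xs) = cong suc (length-init y xs)

init-++-∷ : ∀ (xs : List X) y ys → init (xs ++ y ∷ ys) ≡ xs ++ init (y ∷ ys)
init-++-∷ []            y ys = refl
init-++-∷ (x ∷ [])      y ys = refl
init-++-∷ (x ∷ x′ ∷ xs) y ys = cong (x ∷_) (init-++-∷ (x′ ∷ xs) y ys)

init-prefix : ∀ (xs : List X) → ∃[ z ] (xs ≡ init xs ++ z)
init-prefix []           = [] , refl
init-prefix (x ∷ [])     = [ x ] , refl
init-prefix (x ∷ y ∷ xs) = let z , eq = init-prefix (y ∷ xs) in z , cong (x ∷_) eq

factor-trans : {r s t : List X} → Factor r s → Factor s t → Factor r t
factor-trans {r = r} (x , y , refl) (x′ , y′ , refl) = x′ ++ x , y ++ y′ , (begin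
  x′ ++ (x ++ r ++ y) ++ y′  ≡⟨ cong (x′ ++_) (++-assoc x (r ++ y) y′) ⟩
  x′ ++ x ++ (r ++ y) ++ y′  ≡⟨ cong (λ z → x′ ++ x ++ z) (++-assoc r y y′) ⟩
  x′ ++ x ++ r ++ y ++ y′    ≡⟨ sym (++-assoc x′ x _) ⟩
  (x′ ++ x) ++ r ++ y ++ y′  ∎)

length-factor : {t s : List X} → Factor t s → length t ≤ length s
length-factor {t = t} (x , y , refl) = ≤-trans (length-++-≤ˡ t) (length-++-≤ʳ (t ++ y) {x})

init-factor : (xs : List X) → Factor (init xs) xs
init-factor xs = [] , init-prefix xs

drop-factor : (xs : List X) → Factor (drop 1 xs) xs
drop-factor []       = [] , [] , refl
drop-factor (x ∷ xs) = [ x ] , [] , cong (x ∷_) (sym (++-identityʳ xs))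

length<⇒≢ : {t s : List X} → length t < length s → t ≢ s
length<⇒≢ t<s t≡s = <⇒≢ t<s (cong length t≡s)

init-properFactor : ∀ (x : X) xs → ProperFactor (init (x ∷ xs)) (x ∷ xs)
init-properFactor x xs = init-factor (x ∷ xs) , length<⇒≢ (≤-reflexive (cong suc (length-init x xs)))

drop-properFactor : ∀ (x : X) xs → ProperFactor xs (x ∷ xs)
drop-properFactor x xs = drop-factor (x ∷ xs) , length<⇒≢ (n<1+n (length xs))

properFactor⇒factor-init⊎drop : {t s : List X} → ProperFactor t s → Factor t (init s) ⊎ Factor t (drop 1 s)
properFactor⇒factor-init⊎drop {t = t} ((x , y ∷ ys , refl) , _) = inj₁ (x , init (y ∷ ys) , (begin
  init (x ++ t ++ y ∷ ys)    ≡⟨ cong init (sym (++-assoc x t (y ∷ ys))) ⟩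
  init ((x ++ t) ++ y ∷ ys)  ≡⟨ init-++-∷ (x ++ t) y ys ⟩
  (x ++ t) ++ init (y ∷ ys)  ≡⟨ ++-assoc x t _ ⟩
  x ++ t ++ init (y ∷ ys)    ∎))
properFactor⇒factor-init⊎drop ((x ∷ xs , [] , refl) , _) = inj₂ (xs , [] , refl)
properFactor⇒factor-init⊎drop {t = t} (([] , [] , refl) , t≢s) = contradiction (sym (++-identityʳ t)) t≢s

module _ {m} {Sym : Set} {A : NFA m Sym} where

  Run-++⁺ : ∀ {p q r x y} → Run A p x q → Run A q y r → Run A p (x ++ y) r
  Run-++⁺ run-nil         r₂ = r₂
  Run-++⁺ (run-cons d r₁) r₂ = run-cons d (Run-++⁺ r₁ r₂)

  Run-++⁻ : ∀ {p r} x {y} → Run A p (x ++ y) r → ∃[ q ] (Run A p x q × Run A q y r)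
  Run-++⁻ []      r              = _ , run-nil , r
  Run-++⁻ (a ∷ x) (run-cons d r) = let q , r₁ , r₂ = Run-++⁻ x r in q , run-cons d r₁ , r₂

record Finite (e : ℕ) (X : Set) : Set where
  field
    size  : ℕ
    size≤ : size ≤ 2 ^ e
    enum  : X ↔ Fin size
open Finite

Finite-↔ : X ↔ Y → Finite e Y → Finite e X
Finite-↔ X↔Y F = record { size = size F ; size≤ = size≤ F ; enum = ↔-trans X↔Y (enum F) }

Finite-weaken : e ≤ e′ → Finite e X → Finite e′ X
Finite-weaken e≤e′ F = record { size = size F ; size≤ = ≤-trans (size≤ F) (^-monoʳ-≤ 2 e≤e′) ; enum = enum F }

Finite-⊤ : Finite 0 ⊤
Finite-⊤ = record { size = 1 ; size≤ = ≤-refl ; enum = ↔-sym 1↔⊤ }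

Finite-Bool : Finite 1 Bool
Finite-Bool = record { size = 2 ; size≤ = ≤-refl ; enum = ↔-sym 2↔Bool }

Finite-Fin : n ≤ 2 ^ e → Finite e (Fin n)
Finite-Fin n≤2^e = record { size = _ ; size≤ = n≤2^e ; enum = ↔-refl }

Finite-× : Finite a X → Finite b Y → Finite (a + b) (X × Y)
Finite-× {a} {b = b} F G = record
  { size  = size F * size G
  ; size≤ = ≤-trans (*-mono-≤ (size≤ F) (size≤ G)) (≤-reflexive (sym (^-distribˡ-+-* 2 a b)))
  ; enum  = ↔-trans (enum F ×-↔ enum G) (↔-sym *↔×)
  }

Finite-Subset : ∀ n → Finite n (Subset n)
Finite-Subset zero    = Finite-↔ (mk↔ₛ′ (λ _ → tt) (λ _ → []) (λ _ → refl) λ { [] → refl }) Finite-⊤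
Finite-Subset (suc n) = Finite-↔ Vec↔× (Finite-× Finite-Bool (Finite-Subset n))
  where
  Vec↔× : Vec Bool (suc n) ↔ (Bool × Vec Bool n)
  Vec↔× = mk↔ₛ′ (λ { (x ∷ xs) → x , xs }) (λ (x , xs) → x ∷ xs) (λ _ → refl) λ { (x ∷ xs) → refl }

record DFA (S : Set) (e : ℕ) (L : Pred (List S) 0ℓ) : Set₁ where
  field
    State      : Set
    finite     : Finite e State
    start      : State
    step       : State → S → State
    Accept     : Pred State 0ℓ
    accept?    : Decidable Accept
    recognises : ∀ w → Accept (foldl step start w) ⇔ L w
open DFA

private
  variable
    L L′ L₁ L₂ : Pred (List S) 0ℓ

weakenᴰ : e ≤ e′ → DFA S e L → DFA S e′ L
weakenᴰ e≤e′ D = record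
  { State = State D ; finite = Finite-weaken e≤e′ (finite D) ; start = start D ; step = step D
  ; Accept = Accept D ; accept? = accept? D ; recognises = recognises D }

castᴰ : (∀ w → L w ⇔ L′ w) → DFA S e L → DFA S e L′
castᴰ L⇔L′ D = record
  { State = State D ; finite = finite D ; start = start D ; step = step D
  ; Accept = Accept D ; accept? = accept? D ; recognises = λ w → ⇔-trans (recognises D w) (L⇔L′ w) }

constᴰ : {Q : Set} → Dec Q → DFA S 0 (λ _ → Q)
constᴰ Q? = record
  { State = ⊤ ; finite = Finite-⊤ ; start = tt ; step = λ _ _ → tt
  ; Accept = λ _ → _ ; accept? = λ _ → Q? ; recognises = λ _ → ⇔-refl }

nonEmptyᴰ : DFA S 1 (λ w → 0 < length w)
nonEmptyᴰ {S = S} = record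
  { State = Bool ; finite = Finite-Bool ; start = false ; step = λ _ _ → true
  ; Accept = _≡ true ; accept? = _≟ᵇ true ; recognises = recognises-nonEmpty }
  where
  foldl-true : ∀ (w : List S) → foldl (λ _ _ → true) true w ≡ true
  foldl-true []      = refl
  foldl-true (_ ∷ w) = foldl-true w
  recognises-nonEmpty : ∀ w → foldl (λ _ _ → true) false w ≡ true ⇔ 0 < length w
  recognises-nonEmpty []      = mk⇔ (λ ()) (λ ())
  recognises-nonEmpty (_ ∷ w) = mk⇔ (λ _ → s≤s z≤n) (λ _ → foldl-true w)

infixr 6 _∩ᴰ_
_∩ᴰ_ : DFA S a L₁ → DFA S b L₂ → DFA S (a + b) (L₁ ∩ L₂)
_∩ᴰ_ {S = S} {L₁ = L₁} {L₂ = L₂} D₁ D₂ = record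
  { State      = State D₁ × State D₂
  ; finite     = Finite-× (finite D₁) (finite D₂)
  ; start      = start D₁ , start D₂
  ; step       = step×
  ; Accept     = λ (x , y) → Accept D₁ x × Accept D₂ y
  ; accept?    = λ (x , y) → accept? D₁ x ×-dec accept? D₂ y
  ; recognises = recognises-∩ }
  where
  step× : State D₁ × State D₂ → S → State D₁ × State D₂
  step× (x , y) c = step D₁ x c , step D₂ y c
  foldl-step× : ∀ x y w → foldl step× (x , y) w ≡ (foldl (step D₁) x w , foldl (step D₂) y w)
  foldl-step× x y []      = refl
  foldl-step× x y (c ∷ w) = foldl-step× (step D₁ x c) (step D₂ y c) w
  recognises-∩ : ∀ w → let (x , y) = foldl step× (start D₁ , start D₂) w in
                 (Accept D₁ x × Accept D₂ y) ⇔ (L₁ w × L₂ w)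
  recognises-∩ w rewrite foldl-step× (start D₁) (start D₂) w = recognises D₁ w ×-⇔ recognises D₂ w

∁ᴰ : DFA S e L → DFA S e (∁ L)
∁ᴰ D = record
  { State = State D ; finite = finite D ; start = start D ; step = step D
  ; Accept = ∁ (Accept D) ; accept? = λ x → ¬? (accept? D x) ; recognises = λ w → ¬-cong-⇔ (recognises D w) }

mapᴰ : (f : S → T) → DFA T e L → DFA S e (map f ⊢ L)
mapᴰ {L = L} f D = record
  { State = State D ; finite = finite D ; start = start D ; step = λ x c → step D x (f c)
  ; Accept = Accept D ; accept? = accept? D
  ; recognises = λ w → subst (λ s → Accept D s ⇔ L (map f w)) (foldl-map (step D) f (start D) w)
                              (recognises D (map f w)) }

initᴰ : DFA S e L → DFA S (e + e) (init ⊢ L)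
initᴰ {S = S} {L = L} D = record
  { State      = State D × State D
  ; finite     = Finite-× (finite D) (finite D)
  ; start      = start D , start D
  ; step       = step²
  ; Accept     = λ (x , _) → Accept D x
  ; accept?    = λ (x , _) → accept? D x
  ; recognises = λ w → subst (λ s → Accept D s ⇔ L (init w)) (sym (run-init w)) (recognises D (init w)) }
  where
  step² : State D × State D → S → State D × State D
  step² (_ , x) c = x , step D x c
  foldl-step²-∷ : ∀ y x c w →
    foldl step² (y , x) (c ∷ w) ≡ (foldl (step D) x (init (c ∷ w)) , foldl (step D) x (c ∷ w))
  foldl-step²-∷ y x c []       = refl
  foldl-step²-∷ y x c (c′ ∷ w) = foldl-step²-∷ x (step D x c) c′ w
  run-init : ∀ w → proj₁ (foldl step² (start D , start D) w) ≡ foldl (step D) (start D) (init w)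
  run-init []      = refl
  run-init (c ∷ w) = cong proj₁ (foldl-step²-∷ (start D) (start D) c w)

tailᴰ : DFA S e L → DFA S (suc e) (drop 1 ⊢ L)
tailᴰ {S = S} {L = L} D = record
  { State      = Bool × State D
  ; finite     = Finite-× Finite-Bool (finite D)
  ; start      = false , start D
  ; step       = skip
  ; Accept     = λ (_ , x) → Accept D x
  ; accept?    = λ (_ , x) → accept? D x
  ; recognises = λ w → subst (λ s → Accept D s ⇔ L (drop 1 w)) (sym (run-drop w)) (recognises D (drop 1 w)) }
  where
  skip : Bool × State D → S → Bool × State D
  skip (false , x) _ = true , x
  skip (true  , x) c = true , step D x c
  foldl-skip : ∀ x w → foldl skip (true , x) w ≡ (true , foldl (step D) x w)
  foldl-skip x []      = refl
  foldl-skip x (c ∷ w) = foldl-skip (step D x c) w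
  run-drop : ∀ w → proj₂ (foldl skip (false , start D) w) ≡ foldl (step D) (start D) (drop 1 w)
  run-drop []      = refl
  run-drop (c ∷ w) = cong proj₂ (foldl-skip (start D) w)

dec-true⁻¹ : ∀ {P : Set} (P? : Dec P) → does P? ≡ true → P
dec-true⁻¹ (yes p) _ = p

DFA⇒NFA : DFA S e L → ∃[ n ] ∃[ B ] (n ≤ 2 ^ e × (∀ w → Accepts {n} B w ⇔ L w))
DFA⇒NFA {S = S} D = size (finite D) , B , size≤ (finite D) , λ w → ⇔-trans (accepts⇔ w) (recognises D w)
  where
  open Inverse (enum (finite D)) renaming (to to encode; from to decode)
  B : NFA (size (finite D)) S
  B = record
    { δ     = λ i c j → does (j ≟ᶠ encode (step D (decode i) c))
    ; q₀    = encode (start D)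
    ; final = λ j → does (accept? D (decode j)) }
  run⇒ : ∀ {i w j} → Run B i w j → decode j ≡ foldl (step D) (decode i) w
  run⇒ run-nil = refl
  run⇒ {i} (run-cons {q = q} {a = c} {w = w} d r) = trans (run⇒ r) (cong (λ s → foldl (step D) s w) decode-q)
    where
    decode-q : decode q ≡ step D (decode i) c
    decode-q = trans (cong decode (dec-true⁻¹ (_ ≟ᶠ _) d)) (strictlyInverseʳ _)
  run⇐ : ∀ x w → Run B (encode x) w (encode (foldl (step D) x w))
  run⇐ x []      = run-nil
  run⇐ x (c ∷ w) = run-cons (dec-true (_ ≟ᶠ _) (cong (λ s → encode (step D s c)) (sym (strictlyInverseʳ x))))
                            (run⇐ (step D x c) w)
  accepts⇔ : ∀ w → Accepts B w ⇔ Accept D (foldl (step D) (start D) w)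
  accepts⇔ w = mk⇔
    (λ (j , r , fin) → subst (Accept D)
                         (trans (run⇒ r) (cong (λ s → foldl (step D) s w) (strictlyInverseʳ _)))
                         (dec-true⁻¹ (accept? D _) fin))
    (λ acc → _ , run⇐ (start D) w , dec-true (accept? D _) (subst (Accept D) (sym (strictlyInverseʳ _)) acc))

module PositionalWords (lam : ℕ) .{{_ : NonZero lam}} where

  toℕ-mod : ∀ n → toℕ (n mod lam) ≡ n % lam
  toℕ-mod n = toℕ-fromℕ< (m%n<n n lam)

  %≡⇒mod≡ : ∀ {m n} → m % lam ≡ n % lam → m mod lam ≡ n mod lam
  %≡⇒mod≡ {m} {n} eq = fromℕ<-cong _ _ eq (m%n<n m lam) (m%n<n n lam)

  mod≡⇒%≡ : ∀ {m n} → m mod lam ≡ n mod lam → m % lam ≡ n % lam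
  mod≡⇒%≡ {m} {n} eq = trans (sym (toℕ-mod m)) (trans (cong toℕ eq) (toℕ-mod n))

  suc-%-cong : ∀ {m n} → m % lam ≡ n % lam → suc m % lam ≡ suc n % lam
  suc-%-cong {m} {n} eq = begin
    suc m % lam                ≡⟨ %-distribˡ-+ 1 m lam ⟩
    (1 % lam + m % lam) % lam  ≡⟨ cong (λ r → (1 % lam + r) % lam) eq ⟩
    (1 % lam + n % lam) % lam  ≡⟨ sym (%-distribˡ-+ 1 n lam) ⟩
    suc n % lam                ∎

  ≡[mod]⇔%≡ : ∀ {m n} → m ≡ n [mod lam ] ⇔ m % lam ≡ n % lam
  ≡[mod]⇔%≡ {m} {n} = mk⇔
    (λ (q , r , eq) → trans (sym ([m+kn]%n≡m%n m q lam)) (trans (cong (_% lam) eq) ([m+kn]%n≡m%n n r lam)))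
    (λ eq → n / lam , m / lam , (begin
      m + n / lam * lam                               ≡⟨ cong (_+ n / lam * lam) (m≡m%n+[m/n]*n m lam) ⟩
      m % lam + m / lam * lam + n / lam * lam         ≡⟨ cong (λ r → r + m / lam * lam + n / lam * lam) eq ⟩
      n % lam + m / lam * lam + n / lam * lam         ≡⟨ xy∙z≈xz∙y (n % lam) _ _ ⟩
      n % lam + n / lam * lam + m / lam * lam         ≡⟨ cong (_+ m / lam * lam) (sym (m≡m%n+[m/n]*n n lam)) ⟩
      n + m / lam * lam                               ∎))

  label⇔ : ∀ {p : Fin lam} {n} → toℕ p ≡ n [mod lam ] ⇔ p ≡ n mod lam
  label⇔ {p} {n} = mk⇔
    (λ p≡n → toℕ-injective (begin
      toℕ p            ≡⟨ sym (m<n⇒m%n≡m (toℕ<n p)) ⟩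
      toℕ p % lam      ≡⟨ to ≡[mod]⇔%≡ p≡n ⟩
      n % lam          ≡⟨ sym (toℕ-mod n) ⟩
      toℕ (n mod lam)  ∎))
    (λ { refl → from ≡[mod]⇔%≡ (trans (cong (_% lam) (toℕ-mod n)) (m%n%n≡m%n n lam)) })

  letters : List (Fin lam × S) → List S
  letters = map proj₂

  ⟨_∶_⟩ : ℕ → List S → List (Fin lam × S)
  ⟨ n ∶ [] ⟩    = []
  ⟨ n ∶ a ∷ u ⟩ = (n mod lam , a) ∷ ⟨ suc n ∶ u ⟩

  length-⟨⟩ : ∀ n (u : List S) → length ⟨ n ∶ u ⟩ ≡ length u
  length-⟨⟩ n []      = refl
  length-⟨⟩ n (a ∷ u) = cong suc (length-⟨⟩ (suc n) u)

  letters-⟨⟩ : ∀ n (u : List S) → letters ⟨ n ∶ u ⟩ ≡ u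
  letters-⟨⟩ n []      = refl
  letters-⟨⟩ n (a ∷ u) = cong (a ∷_) (letters-⟨⟩ (suc n) u)

  ≡⟨letters⟩ : ∀ {n} {u : List S} {w} → w ≡ ⟨ n ∶ u ⟩ → w ≡ ⟨ n ∶ letters w ⟩
  ≡⟨letters⟩ {n = n} {u = u} refl = cong ⟨ n ∶_⟩ (sym (letters-⟨⟩ n u))

  ⟨⟩-cong : ∀ {m n} (u : List S) → m % lam ≡ n % lam → ⟨ m ∶ u ⟩ ≡ ⟨ n ∶ u ⟩
  ⟨⟩-cong []      _  = refl
  ⟨⟩-cong (a ∷ u) eq = cong₂ _∷_ (cong (_, a) (%≡⇒mod≡ eq)) (⟨⟩-cong u (suc-%-cong eq))

  ⟨⟩-++ : ∀ n (x y : List S) → ⟨ n ∶ x ++ y ⟩ ≡ ⟨ n ∶ x ⟩ ++ ⟨ n + length x ∶ y ⟩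
  ⟨⟩-++ n []      y = cong ⟨_∶ y ⟩ (sym (+-identityʳ n))
  ⟨⟩-++ n (a ∷ x) y = cong ((n mod lam , a) ∷_) (begin
    ⟨ suc n ∶ x ++ y ⟩                           ≡⟨ ⟨⟩-++ (suc n) x y ⟩
    ⟨ suc n ∶ x ⟩ ++ ⟨ suc n + length x ∶ y ⟩    ≡⟨ cong (λ k → ⟨ suc n ∶ x ⟩ ++ ⟨ k ∶ y ⟩) (sym (+-suc n (length x))) ⟩
    ⟨ suc n ∶ x ⟩ ++ ⟨ n + suc (length x) ∶ y ⟩  ∎)

  ⟨⟩-++⁻ : ∀ n (v : List S) x z → ⟨ n ∶ v ⟩ ≡ x ++ z →
           x ≡ ⟨ n ∶ letters x ⟩ × z ≡ ⟨ n + length x ∶ letters z ⟩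
  ⟨⟩-++⁻ n v [] z eq = refl , subst (λ k → z ≡ ⟨ k ∶ letters z ⟩) (sym (+-identityʳ n)) (≡⟨letters⟩ (sym eq))
  ⟨⟩-++⁻ n (a ∷ v) (b ∷ x) z eq with refl , eq′ ← ∷-injective eq =
    let x≡ , z≡ = ⟨⟩-++⁻ (suc n) v x z eq′
    in cong (b ∷_) x≡ , trans z≡ (cong (λ k → ⟨ k ∶ letters z ⟩) (sym (+-suc n (length x))))

  init-⟨⟩ : ∀ n (u : List S) → init ⟨ n ∶ u ⟩ ≡ ⟨ n ∶ init u ⟩
  init-⟨⟩ n []          = refl
  init-⟨⟩ n (a ∷ [])    = refl
  init-⟨⟩ n (a ∷ b ∷ u) = cong ((n mod lam , a) ∷_) (init-⟨⟩ (suc n) (b ∷ u))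

  drop-⟨⟩ : ∀ n (u : List S) → drop 1 ⟨ n ∶ u ⟩ ≡ ⟨ suc n ∶ drop 1 u ⟩
  drop-⟨⟩ n []      = refl
  drop-⟨⟩ n (a ∷ u) = refl

  PosRep⇔ : ∀ {n} {u : List S} {w} → PosRep lam n u w ⇔ w ≡ ⟨ n ∶ u ⟩
  PosRep⇔ = mk⇔ PosRep⇒ PosRep⇐
    where
    PosRep⇒ : ∀ {n} {u : List S} {w} → PosRep lam n u w → w ≡ ⟨ n ∶ u ⟩
    PosRep⇒ pos-nil            = refl
    PosRep⇒ (pos-cons p≡n rep) = cong₂ _∷_ (cong (_, _) (to label⇔ p≡n)) (PosRep⇒ rep)
    PosRep⇐ : ∀ {n} {u : List S} {w} → w ≡ ⟨ n ∶ u ⟩ → PosRep lam n u w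
    PosRep⇐ {u = []}    refl = pos-nil
    PosRep⇐ {u = a ∷ u} refl = pos-cons (from label⇔ refl) (PosRep⇐ refl)

  positional-⟨⟩ : ∀ {n} {u : List S} → 0 < length u → Positional lam ⟨ n ∶ u ⟩
  positional-⟨⟩ {n = n} {u = u} 0<u = n , u , 0<u , from PosRep⇔ refl

  positional-length : ∀ {w : List (Fin lam × S)} → Positional lam w → 0 < length w
  positional-length (n , u , 0<u , rep) rewrite to PosRep⇔ rep = subst (0 <_) (sym (length-⟨⟩ n u)) 0<u

  positional-factor : ∀ {τ′ τ : List (Fin lam × S)} →
                      Positional lam τ → Factor τ′ τ → 0 < length τ′ → Positional lam τ′
  positional-factor {τ′ = τ′} (n , u , _ , rep) (x , y , τ≡) 0<τ′ =
    n + length x , letters τ′ , subst (0 <_) (sym (length-map proj₂ τ′)) 0<τ′ , from PosRep⇔ τ′≡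
    where
    suffix : τ′ ++ y ≡ ⟨ n + length x ∶ letters (τ′ ++ y) ⟩
    suffix = proj₂ (⟨⟩-++⁻ n u x (τ′ ++ y) (trans (sym (to PosRep⇔ rep)) τ≡))
    τ′≡ : τ′ ≡ ⟨ n + length x ∶ letters τ′ ⟩
    τ′≡ = proj₁ (⟨⟩-++⁻ (n + length x) _ τ′ y (sym suffix))

  ×∃PosRep⇔ : ∀ {n} (P : Pred (List (Fin lam × S)) 0ℓ) {w} →
    (P w × ∃[ u ] PosRep lam n u w) ⇔ (w ≡ ⟨ n ∶ letters w ⟩ × P ⟨ n ∶ letters w ⟩)
  ×∃PosRep⇔ {n = n} P {w} = mk⇔
    (λ (Pw , u , rep) → let w≡ = ≡⟨letters⟩ (to PosRep⇔ rep) in w≡ , subst P w≡ Pw)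
    (λ (w≡ , Pw) → subst P (sym w≡) Pw , letters w , from PosRep⇔ w≡)

  positionalᴰ : lam ≤ 2 ^ e → ∀ n → DFA (Fin lam × S) (suc e) (λ w → w ≡ ⟨ n ∶ letters w ⟩)
  positionalᴰ {S = S} lam≤2^e n = record
    { State      = Bool × Fin lam
    ; finite     = Finite-× Finite-Bool (Finite-Fin lam≤2^e)
    ; start      = true , n mod lam
    ; step       = expect
    ; Accept     = λ (ok , _) → ok ≡ true
    ; accept?    = λ (ok , _) → ok ≟ᵇ true
    ; recognises = expect-correct n }
    where
    next : Fin lam → Fin lam
    next r = suc (toℕ r) mod lam
    next-mod : ∀ k → next (k mod lam) ≡ suc k mod lam
    next-mod k = %≡⇒mod≡ (suc-%-cong (trans (cong (_% lam) (toℕ-mod k)) (m%n%n≡m%n k lam)))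
    expect : Bool × Fin lam → Fin lam × S → Bool × Fin lam
    expect (true  , r) (l , _) = does (l ≟ᶠ r) , next r
    expect (false , r) _       = false , r
    expect-stuck : ∀ r w → foldl expect (false , r) w ≡ (false , r)
    expect-stuck r []      = refl
    expect-stuck r (_ ∷ w) = expect-stuck r w
    expect-correct : ∀ k w → proj₁ (foldl expect (true , k mod lam) w) ≡ true ⇔ w ≡ ⟨ k ∶ letters w ⟩
    expect-correct k []            = mk⇔ (λ _ → refl) (λ _ → refl)
    expect-correct k ((l , a) ∷ w) with l ≟ᶠ k mod lam
    ... | yes refl rewrite next-mod k =
      ⇔-trans (expect-correct (suc k) w) (mk⇔ (cong ((k mod lam , a) ∷_)) ∷-injectiveʳ)
    ... | no l≢k rewrite expect-stuck (next (k mod lam)) w =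
      mk⇔ (λ ()) (λ eq → contradiction (cong proj₁ (∷-injectiveˡ eq)) l≢k)

module BlockingFactors {m} {Sym : Set} (A : NFA m Sym) (lam : ℕ) .{{_ : NonZero lam}} where
  open PositionalWords lam

  -- ⟨ c ∶ u ⟩ is a factor of some word of L̂(A)
  Live : ℕ → List Sym → Set
  Live c u = ∃[ x ] ∃[ y ] (length x % lam ≡ c % lam × Accepts A (x ++ u ++ y))

  factor-offset : ∀ {v c} {u : List Sym} x y → ⟨ 0 ∶ v ⟩ ≡ x ++ ⟨ c ∶ u ⟩ ++ y → 0 < length u →
                  length x % lam ≡ c % lam
  factor-offset {u = _ ∷ _} x y eq _ = sym (mod≡⇒%≡ (cong proj₁ (∷-injectiveˡ (proj₂ (⟨⟩-++⁻ 0 _ x _ eq)))))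

  blocking-⟨⟩⇔ : ∀ {c} {u : List Sym} → Blocking A lam ⟨ c ∶ u ⟩ ⇔ (0 < length u × ¬ Live c u)
  blocking-⟨⟩⇔ {c} {u} = mk⇔ (λ b → nonEmpty b , ¬live b) (λ (0<u , ¬live) → blocking 0<u ¬live)
    where
    nonEmpty : Blocking A lam ⟨ c ∶ u ⟩ → 0 < length u
    nonEmpty (pos , _) = subst (0 <_) (length-⟨⟩ c u) (positional-length pos)

    ¬live : Blocking A lam ⟨ c ∶ u ⟩ → ¬ Live c u
    ¬live b@(_ , blocks) (x , y , x≡c , acc) =
      blocks ⟨ 0 ∶ x ++ u ++ y ⟩ (positional-⟨⟩ (≤-trans (nonEmpty b) (length-factor (x , y , refl))))
             occurs (x ++ u ++ y , acc , from PosRep⇔ refl)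
      where
      occurs : Factor ⟨ c ∶ u ⟩ ⟨ 0 ∶ x ++ u ++ y ⟩
      occurs = ⟨ 0 ∶ x ⟩ , ⟨ length x + length u ∶ y ⟩ , (begin
        ⟨ 0 ∶ x ++ u ++ y ⟩                                          ≡⟨ ⟨⟩-++ 0 x (u ++ y) ⟩
        ⟨ 0 ∶ x ⟩ ++ ⟨ length x ∶ u ++ y ⟩                           ≡⟨ cong (⟨ 0 ∶ x ⟩ ++_) (⟨⟩-++ (length x) u y) ⟩
        ⟨ 0 ∶ x ⟩ ++ ⟨ length x ∶ u ⟩ ++ ⟨ length x + length u ∶ y ⟩ ≡⟨ cong (λ t → ⟨ 0 ∶ x ⟩ ++ t ++ _) (⟨⟩-cong u x≡c) ⟩
        ⟨ 0 ∶ x ⟩ ++ ⟨ c ∶ u ⟩ ++ ⟨ length x + length u ∶ y ⟩        ∎)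

    blocking : 0 < length u → ¬ Live c u → Blocking A lam ⟨ c ∶ u ⟩
    blocking 0<u ¬live = positional-⟨⟩ 0<u , blocks
      where
      blocks : ∀ σ → Positional lam σ → Factor ⟨ c ∶ u ⟩ σ → ¬ InLHat A lam σ
      blocks σ _ (x , y , σ≡) (v , acc , rep) =
        ¬live (letters x , letters y , offset , subst (Accepts A) v≡ acc)
        where
        ⟨v⟩≡ : ⟨ 0 ∶ v ⟩ ≡ x ++ ⟨ c ∶ u ⟩ ++ y
        ⟨v⟩≡ = trans (sym (to PosRep⇔ rep)) σ≡
        offset : length (letters x) % lam ≡ c % lam
        offset = trans (cong (_% lam) (length-map proj₂ x)) (factor-offset x y ⟨v⟩≡ 0<u)
        v≡ : v ≡ letters x ++ u ++ letters y
        v≡ = begin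
          v                                                   ≡⟨ sym (letters-⟨⟩ 0 v) ⟩
          letters ⟨ 0 ∶ v ⟩                                 ≡⟨ cong letters ⟨v⟩≡ ⟩
          letters (x ++ ⟨ c ∶ u ⟩ ++ y)                     ≡⟨ map-++ proj₂ x _ ⟩
          letters x ++ letters (⟨ c ∶ u ⟩ ++ y)           ≡⟨ cong (letters x ++_) (map-++ proj₂ ⟨ c ∶ u ⟩ y) ⟩
          letters x ++ letters ⟨ c ∶ u ⟩ ++ letters y   ≡⟨ cong (λ t → letters x ++ t ++ letters y) (letters-⟨⟩ c u) ⟩
          letters x ++ u ++ letters y                     ∎

  blocking-extend : ∀ {τ′ τ} → Blocking A lam τ′ → Factor τ′ τ → Positional lam τ → Blocking A lam τ
  blocking-extend (_ , blocks′) τ′⊑τ pos = pos , λ σ σ-pos τ⊑σ → blocks′ σ σ-pos (factor-trans τ′⊑τ τ⊑σ)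

  minBlocking⇒ : ∀ τ → MinBlocking A lam τ → ¬ Blocking A lam (init τ) × ¬ Blocking A lam (drop 1 τ)
  minBlocking⇒ []      ((pos , _) , _) = contradiction (positional-length pos) λ ()
  minBlocking⇒ (t ∷ τ) (_ , minimal)   = minimal _ (init-properFactor t τ) , minimal _ (drop-properFactor t τ)

  minBlocking⇐ : ∀ {τ} → Blocking A lam τ → ¬ Blocking A lam (init τ) → ¬ Blocking A lam (drop 1 τ) →
                 MinBlocking A lam τ
  minBlocking⇐ {τ} b ¬b-init ¬b-drop = b , minimal
    where
    extend : ∀ {τ′ ρ} → Blocking A lam τ′ → Factor τ′ ρ → Factor ρ τ → Blocking A lam ρ
    extend b′ τ′⊑ρ ρ⊑τ = blocking-extend b′ τ′⊑ρ
      (positional-factor (proj₁ b) ρ⊑τ (≤-trans (positional-length (proj₁ b′)) (length-factor τ′⊑ρ)))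
    minimal : ∀ τ′ → ProperFactor τ′ τ → ¬ Blocking A lam τ′
    minimal τ′ τ′⊏τ b′ with properFactor⇒factor-init⊎drop τ′⊏τ
    ... | inj₁ τ′⊑init = ¬b-init (extend b′ τ′⊑init (init-factor τ))
    ... | inj₂ τ′⊑drop = ¬b-drop (extend b′ τ′⊑drop (drop-factor τ))

  minBlocking-⟨⟩⇔ : ∀ {c} {u : List Sym} → MinBlocking A lam ⟨ c ∶ u ⟩ ⇔
    (Blocking A lam ⟨ c ∶ u ⟩ × ¬ Blocking A lam ⟨ c ∶ init u ⟩ × ¬ Blocking A lam ⟨ suc c ∶ drop 1 u ⟩)
  minBlocking-⟨⟩⇔ {c} {u} rewrite sym (init-⟨⟩ c u) | sym (drop-⟨⟩ c u) =
    mk⇔ (λ mb → proj₁ mb , minBlocking⇒ _ mb) (λ (b , ¬b-init , ¬b-drop) → minBlocking⇐ b ¬b-init ¬b-drop)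

subsetOf : {P : Pred (Fin n) 0ℓ} → Decidable P → Subset n
subsetOf P? = tabulate (λ x → does (P? x))

∈-subsetOf⇔ : {P : Pred (Fin n) 0ℓ} (P? : Decidable P) {x : Fin n} → x ∈ subsetOf P? ⇔ P x
∈-subsetOf⇔ P? {x} = mk⇔
  (λ x∈ → dec-true⁻¹ (P? x) (trans (sym (lookup∘tabulate _ x)) ([]=⇒lookup x∈)))
  (λ Px → lookup⇒[]= x _ (trans (lookup∘tabulate _ x) (dec-true (P? x) Px)))

module SubsetConstruction {m} {Sym : Set} (A : NFA m Sym) where

  post : Subset m → Sym → Subset m
  post P a = subsetOf (λ q → any? (λ p → p ∈? P ×-dec δ A p a q ≟ᵇ true))

  ∈-post⇔ : ∀ {P a q} → q ∈ post P a ⇔ (∃[ p ] (p ∈ P × δ A p a q ≡ true))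
  ∈-post⇔ {P} {a} = ∈-subsetOf⇔ (λ q → any? (λ p → p ∈? P ×-dec δ A p a q ≟ᵇ true))

  ∈-foldl-post⇔ : ∀ P u {q} → q ∈ foldl post P u ⇔ (∃[ p ] (p ∈ P × Run A p u q))
  ∈-foldl-post⇔ P []      = mk⇔ (λ q∈P → _ , q∈P , run-nil) (λ { (p , p∈P , run-nil) → p∈P })
  ∈-foldl-post⇔ P (a ∷ u) = ⇔-trans (∈-foldl-post⇔ (post P a) u) (mk⇔ first-step first-step⁻¹)
    where
    first-step : ∀ {q} → ∃[ r ] (r ∈ post P a × Run A r u q) → ∃[ p ] (p ∈ P × Run A p (a ∷ u) q)
    first-step (r , r∈ , run) = let p , p∈P , d = to ∈-post⇔ r∈ in p , p∈P , run-cons d run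
    first-step⁻¹ : ∀ {q} → ∃[ p ] (p ∈ P × Run A p (a ∷ u) q) → ∃[ r ] (r ∈ post P a × Run A r u q)
    first-step⁻¹ (p , p∈P , run-cons d run) = _ , from ∈-post⇔ (p , p∈P , d) , run

  runFromᴰ : {P : Pred (Fin m) 0ℓ} → Decidable P → DFA Sym m (λ u → ∃[ p ] ∃[ q ] (P p × Run A p u q))
  runFromᴰ P? = record
    { State      = Subset m
    ; finite     = Finite-Subset m
    ; start      = subsetOf P?
    ; step       = post
    ; Accept     = Nonempty
    ; accept?    = nonempty?
    ; recognises = λ u → mk⇔
        (λ (q , q∈) → let p , p∈ , run = to (∈-foldl-post⇔ _ u) q∈ in p , q , to (∈-subsetOf⇔ P?) p∈ , run)
        (λ (p , q , Pp , run) → q , from (∈-foldl-post⇔ _ u) (p , from (∈-subsetOf⇔ P?) Pp , run)) }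

n≤2^n : ∀ n → n ≤ 2 ^ n
n≤2^n zero    = z≤n
n≤2^n (suc n) = +-mono-≤ (m^n>0 2 n) (≤-trans (n≤2^n n) (m≤m+n (2 ^ n) 0))

module StronglyConnectedNFA {m} {Sym : Set} (A : NFA m Sym) (sc : StronglyConnected A)
                            (lam : ℕ) .{{_ : NonZero lam}} (period : IsPeriod A lam) where
  open PositionalWords lam
  open BlockingFactors A lam
  open SubsetConstruction A

  cycle-divisible : ∀ {p} w → Run A p w p → lam ∣ length w
  cycle-divisible []        _ = lam ∣0
  cycle-divisible w@(_ ∷ _) r = proj₁ period _ (s≤s z≤n , _ , w , r , refl)

  runs-congruent : ∀ {p q x y} → Run A p x q → Run A p y q → length x % lam ≡ length y % lam
  runs-congruent {p} {q} {x} {y} rx ry with z , rz ← sc q p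
    with divides s x+z≡ ← cycle-divisible (x ++ z) (Run-++⁺ rx rz)
       | divides t y+z≡ ← cycle-divisible (y ++ z) (Run-++⁺ ry rz)
    = to ≡[mod]⇔%≡ (t , s , (begin
      length x + t * lam                ≡⟨ cong (length x +_) (trans (sym y+z≡) (length-++ y)) ⟩
      length x + (length y + length z)  ≡⟨ x∙yz≈y∙xz (length x) (length y) (length z) ⟩
      length y + (length x + length z)  ≡⟨ cong (length y +_) (trans (sym (length-++ x)) x+z≡) ⟩
      length y + s * lam                ∎))

  phase : Fin m → ℕ
  phase p = length (proj₁ (sc (q₀ A) p)) % lam

  phase-run : ∀ {x p} → Run A (q₀ A) x p → length x % lam ≡ phase p
  phase-run r = runs-congruent r (proj₂ (sc (q₀ A) _))

  HasFinal : Set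
  HasFinal = ∃[ f ] final A f ≡ true

  live⇔ : ∀ {c u} → Live c u ⇔ (HasFinal × ∃[ p ] ∃[ q ] (phase p ≡ c % lam × Run A p u q))
  live⇔ {c} {u} = mk⇔ live⇒ live⇐
    where
    live⇒ : Live c u → HasFinal × ∃[ p ] ∃[ q ] (phase p ≡ c % lam × Run A p u q)
    live⇒ (x , y , x≡c , f , run , fin) =
      let p , rx , ruy = Run-++⁻ x run
          q , ru , _   = Run-++⁻ u ruy
      in (f , fin) , p , q , trans (sym (phase-run rx)) x≡c , ru
    live⇐ : HasFinal × ∃[ p ] ∃[ q ] (phase p ≡ c % lam × Run A p u q) → Live c u
    live⇐ ((f , fin) , p , q , p≡c , ru) =
      let x , rx = sc (q₀ A) p
          y , ry = sc q f
      in x , y , p≡c , f , Run-++⁺ rx (Run-++⁺ ru ry) , fin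

  liveᴰ : ∀ c → DFA Sym m (Live c)
  liveᴰ c = castᴰ (λ _ → ⇔-sym live⇔)
    (constᴰ (any? (λ f → final A f ≟ᵇ true)) ∩ᴰ runFromᴰ (λ p → phase p ≟ c % lam))

  blockingᴰ : ∀ c → DFA Sym (suc m) (λ u → Blocking A lam ⟨ c ∶ u ⟩)
  blockingᴰ c = castᴰ (λ _ → ⇔-sym blocking-⟨⟩⇔) (nonEmptyᴰ ∩ᴰ ∁ᴰ (liveᴰ c))

  minBlockingᴰ : ∀ c → DFA Sym (suc m + (suc m + suc m + suc (suc m))) (λ u → MinBlocking A lam ⟨ c ∶ u ⟩)
  minBlockingᴰ c = castᴰ (λ _ → ⇔-sym minBlocking-⟨⟩⇔)
    (blockingᴰ c ∩ᴰ ∁ᴰ (initᴰ (blockingᴰ c)) ∩ᴰ ∁ᴰ (tailᴰ (blockingᴰ (suc c))))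

  closedWalk⇒period≤states : ∀ {c} → Run A (q₀ A) c (q₀ A) → 0 < length c → lam ≤ m
  closedWalk⇒period≤states {c} rc 0<c = injective⇒≤ stateAt-injective
    where
    lam≤c : lam ≤ length c
    lam≤c = ∣⇒≤ {{>-nonZero 0<c}} (cycle-divisible c rc)
    split : ∀ (r : Fin lam) → ∃[ q ] (Run A (q₀ A) (take (toℕ r) c) q × Run A q (drop (toℕ r) c) (q₀ A))
    split r = Run-++⁻ (take (toℕ r) c)
                (subst (λ w → Run A (q₀ A) w (q₀ A)) (sym (take++drop≡id (toℕ r) c)) rc)
    stateAt : Fin lam → Fin m
    stateAt r = proj₁ (split r)
    phase-stateAt : ∀ r → toℕ r ≡ phase (stateAt r)
    phase-stateAt r = begin
      toℕ r                          ≡⟨ sym (m<n⇒m%n≡m (toℕ<n r)) ⟩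
      toℕ r % lam                    ≡⟨ cong (_% lam) (sym (trans (length-take (toℕ r) c) r⊓c≡r)) ⟩
      length (take (toℕ r) c) % lam  ≡⟨ phase-run (proj₁ (proj₂ (split r))) ⟩
      phase (stateAt r)              ∎
      where
      r⊓c≡r : toℕ r ⊓ length c ≡ toℕ r
      r⊓c≡r = m≤n⇒m⊓n≡m (<⇒≤ (<-≤-trans (toℕ<n r) lam≤c))
    stateAt-injective : ∀ {r r′} → stateAt r ≡ stateAt r′ → r ≡ r′
    stateAt-injective {r} {r′} eq =
      toℕ-injective (trans (phase-stateAt r) (trans (cong phase eq) (sym (phase-stateAt r′))))

  cycle⇒period≤states : ∀ {ℓ} → CycleLength A ℓ → lam ≤ m
  cycle⇒period≤states (0<ℓ , p , w , rw , refl) =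
    let x , rx = sc (q₀ A) p
        y , ry = sc p (q₀ A)
    in closedWalk⇒period≤states (Run-++⁺ rx (Run-++⁺ rw ry)) (≤-trans 0<ℓ (length-factor (x , y , refl)))

  -- without cycles every d, in particular 0, would divide lam
  period≤states : lam ≤ m
  period≤states = decidable-stable (lam ≤? m) λ lam≰m →
    ≢-nonZero⁻¹ lam (0∣⇒≡0 (proj₂ period 0 λ ℓ cycle → contradiction (cycle⇒period≤states cycle) lam≰m))

  minBlockingFromᴰ : ∀ n → DFA (Fin lam × Sym) (suc m + (suc m + (suc m + suc m + suc (suc m))))
                               (λ w → MinBlocking A lam w × ∃[ u ] PosRep lam n u w)
  minBlockingFromᴰ n = castᴰ (λ _ → ⇔-sym (×∃PosRep⇔ (MinBlocking A lam)))
    (positionalᴰ (≤-trans period≤states (n≤2^n m)) n ∩ᴰ mapᴰ proj₂ (minBlockingᴰ n))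

exponent≤ : ∀ {m} → 1 ≤ m → suc m + (suc m + (suc m + suc m + suc (suc m))) ≤ 11 * m
exponent≤ {m} 1≤m = ≤-trans (≤-reflexive (regroup m)) (≤-trans
  (+-monoˡ-≤ (5 * m) (*-monoʳ-≤ 6 1≤m))
  (≤-reflexive (sym (*-distribʳ-+ m 6 5))))
  where
  regroup : ∀ m → suc m + (suc m + (suc m + suc m + suc (suc m))) ≡ 6 * 1 + 5 * m
  regroup = solve-∀

lemma21 : ∃[ C ] ((k m : ℕ) (A : NFA m (Fin k)) → StronglyConnected A →
            (lam : ℕ) → IsPeriod A lam → (i : Fin lam) →
            ∃[ m' ] ∃[ B ] (m' ≤ 2 ^ (C * m) ×
              ((w : List (Fin lam × Fin k)) →
                Accepts {m'} B w ⇔ (MinBlocking A lam w × ∃[ u ] PosRep lam (toℕ i) u w))))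
lemma21 = 11 , λ where
  k m A sc zero         _      ()
  k m A sc lam@(suc _) period i →
    let open StronglyConnectedNFA A sc lam period
    in DFA⇒NFA (weakenᴰ (exponent≤ (≤-trans (s≤s z≤n) (toℕ<n (q₀ A)))) (minBlockingFromᴰ (toℕ i)))
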